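{- Let $k>1$ be an odd integer and $(x_1,\dots,x_k)\in\{0,1\}^k$, and let $G^{\mathrm{xor}}(x_1,\dots,x_k)$ be the XOR-gadget. Then: (i) if $x_1\oplus\cdots\oplus x_k=0$, then $G^{\mathrm{xor}}$ has a unique maximum matching; it has size $k$ and it matches the final vertex $t$; (ii) if $x_1\oplus\cdots\oplus x_k=1$, then the maximum matching size of $G^{\mathrm{xor}}$ is $k-1$, and there is a maximum matching of $G^{\mathrm{xor}}$ that does not match $t$.
   Context: For an odd integer $k>1$ and bits $x_1,\dots,x_k$, the XOR-gadget $G^{\mathrm{xor}}(x_1,\dots,x_k)$ is the graph on the $2k$ vertices $s,a_1,b_1,a_2,b_2,\dots,a_{k-1},b_{k-1},t$ ($s$ is the start vertex, $t$ the final vertex) with the following $2k-2$ edges: $s$ is adjacent to $a_1$ if $x_1=0$ and to $b_1$ if $x_1=1$; $t$ is adjacent to $a_{k-1}$ if $x_k=0$ and to $b_{k-1}$ if $x_k=1$; for each $i\in\{2,\dots,k-1\}$, if $x_i=0$ then $a_{i-1}$ is adjacent to $a_i$ and $b_{i-1}$ to $b_i$, and if $x_i=1$ then $a_{i-1}$ is adjacent to $b_i$ and $b_{i-1}$ to $a_i$. $\oplus$ denotes XOR. -}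

module Defs where

open import Data.Nat using (ℕ; zero; suc; ⌊_/2⌋; _≤_)
open import Data.Fin using (Fin; zero; suc; toℕ; fromℕ)
open import Data.Fin.Base using ()
open import Data.List using (List; _∷_; []; _++_; map; length; filterᵇ; allFin)
open import Data.Bool using (Bool; true; false; _xor_)
open import Data.Maybe using (Maybe; just; nothing; is-just)
open import Data.Product using (_×_)
open import Data.Sum using (_⊎_)
open import Relation.Binary.PropositionalEquality using (_≡_)
import Data.Vec.Functional as VF

-- A matching is represented by its (partial) mate function:
-- μ u ≡ just v  means  {u,v} is an edge of the matching.
-- This representation is canonical (one mate function per matching).

IsMatching : {V : Set} → (V → V → Set) → (V → Maybe V) → Set
IsMatching {V} Adj μ = ∀ (u v : V) → μ u ≡ just v → (μ v ≡ just u) × Adj u v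

matchedCount : {V : Set} → List V → (V → Maybe V) → ℕ
matchedCount vs μ = length (filterᵇ (λ v → is-just (μ v)) vs)

-- size of a matching = number of its edges = (number of matched vertices) / 2
msize : {V : Set} → List V → (V → Maybe V) → ℕ
msize vs μ = ⌊ matchedCount vs μ /2⌋

IsMaximumMatching : {V : Set} → List V → (V → V → Set) → (V → Maybe V) → Set
IsMaximumMatching {V} vs Adj μ =
  IsMatching Adj μ × (∀ (ν : V → Maybe V) → IsMatching Adj ν → msize vs ν ≤ msize vs μ)

-- The XOR-gadget for k = suc m.  Vertices: s, t, a i, b i with i : Fin m;
-- `a i` is the paper's a_{i+1}, `b i` is b_{i+1} (so 2 + 2m = 2k vertices).
-- Bits x : Fin k → Bool, with `x j` the paper's x_{j+1}.

data XV (m : ℕ) : Set where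
  s t : XV m
  a b : Fin m → XV m

-- complete, duplicate-free enumeration of the 2k vertices
allXV : (m : ℕ) → List (XV m)
allXV m = s ∷ t ∷ (map a (allFin m) ++ map b (allFin m))

-- the 2k-2 edges (one orientation each)
data XArc {m : ℕ} (x : Fin (suc m) → Bool) : XV m → XV m → Set where
  s-a : (i : Fin m) → toℕ i ≡ 0 → x zero ≡ false → XArc x s (a i)
  s-b : (i : Fin m) → toℕ i ≡ 0 → x zero ≡ true  → XArc x s (b i)
  t-a : (i : Fin m) → suc (toℕ i) ≡ m → x (fromℕ m) ≡ false → XArc x t (a i)
  t-b : (i : Fin m) → suc (toℕ i) ≡ m → x (fromℕ m) ≡ true  → XArc x t (b i)
  aa : (i j : Fin m) → toℕ j ≡ suc (toℕ i) → x (suc i) ≡ false → XArc x (a i) (a j)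
  bb : (i j : Fin m) → toℕ j ≡ suc (toℕ i) → x (suc i) ≡ false → XArc x (b i) (b j)
  ab : (i j : Fin m) → toℕ j ≡ suc (toℕ i) → x (suc i) ≡ true  → XArc x (a i) (b j)
  ba : (i j : Fin m) → toℕ j ≡ suc (toℕ i) → x (suc i) ≡ true  → XArc x (b i) (a j)

XAdj : {m : ℕ} → (Fin (suc m) → Bool) → XV m → XV m → Set
XAdj x u v = XArc x u v ⊎ XArc x v u

xorAll : {n : ℕ} → (Fin n → Bool) → Bool
xorAll x = VF.foldr _xor_ false x

-- Place s at position 0, a_i and b_i at position i and t at position k, and give every vertex a
-- strand bit: s gets x_1 ⊕ ⋯ ⊕ x_k, t gets 0, a_i gets x_{i+1} ⊕ ⋯ ⊕ x_k and b_i its negation.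
-- Two vertices are then adjacent exactly when they lie on the same strand at consecutive
-- positions, so the gadget is a disjoint union of two paths: the one through s starts at position
-- 0, the other at position 1; the one through t ends at position k, the other at position k - 1.
-- If the total XOR is 0, s and t share a path, the two paths have k + 1 and k - 1 vertices, and a
-- path with an even number of vertices has exactly one perfect matching: each vertex is matched
-- forwards or backwards according to the parity of its distance from the start of its path.
-- If the total XOR is 1, both paths have k vertices, so there is no perfect matching, while
-- matching every odd position to the next one leaves only s and t free.

module Submission where

open import Defs
open import Data.Nat using (ℕ; zero; suc; _<_; _%_; _∸_; _+_; _≤_; ⌊_/2⌋; ⌈_/2⌉; z≤n; s≤s; s≤s⁻¹)
open import Data.Nat.Properties
  using (suc-injective; <-asym; <-irrefl; 1+n≰n; ≤-reflexive; ≤-refl; ≤-antisym; ≤-trans; _≤?_; ≰⇒>; <-cmp;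
         m≤n⇒m≤1+n; m≤n⇒m<n∨m≡n; ⌊n/2⌋-mono; n≡⌊n+n/2⌋; n≡⌈n+n/2⌉)
open import Data.Fin using (Fin; zero; suc; toℕ; fromℕ; fromℕ<)
open import Data.Fin.Properties using (toℕ<n; fromℕ<-toℕ; toℕ-fromℕ<)
open import Data.Bool using (Bool; true; false; not; _xor_; if_then_else_; T)
open import Data.Bool.Properties using (_≟_; not-injective; not-involutive; not-¬; xor-same; xor-inverseˡ;
  not-distribˡ-xor; xor-identityʳ; xor-assoc; T?)
open import Data.Maybe using (Maybe; just; nothing; is-just)
open import Data.Maybe.Properties using (just-injective)
open import Data.Product using (_×_; ∃; _,_; proj₁; proj₂)
open import Data.Sum using (_⊎_; inj₁; inj₂; [_,_]; swap)
open import Data.Unit using (tt)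
open import Data.Empty using (⊥-elim)
open import Data.List using (List; _∷_; _++_; map; length; filter; allFin)
open import Data.List.Properties using (length-filter; filter-all; filter-complete; filter-reject; length-++;
  length-map; length-tabulate)
open import Data.List.Membership.Propositional using (_∈_)
open import Data.List.Membership.Propositional.Properties using (∈-filter⁻; ∈-map⁺; ∈-++⁺ˡ; ∈-++⁺ʳ; ∈-allFin)
open import Data.List.Relation.Unary.All using (All; universal)
open import Data.List.Relation.Unary.All.Properties using (map⁺; ++⁺)
open import Data.List.Relation.Unary.Any using (here; there)
open import Function using (_∘_; id)
open import Relation.Nullary using (¬_; yes; no; contradiction)
open import Relation.Unary using (Decidable)
open import Relation.Binary.Definitions using (tri<; tri≈; tri>)
open import Relation.Binary.PropositionalEquality
  using (_≡_; _≢_; refl; sym; trans; cong; cong₂; subst; module ≡-Reasoning)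
open ≡-Reasoning

even : ℕ → Bool
even zero    = true
even (suc n) = not (even n)

%2≡1⇒even≡false : ∀ n → n % 2 ≡ 1 → even n ≡ false
%2≡1⇒even≡false (suc zero)    _ = refl
%2≡1⇒even≡false (suc (suc n)) h = trans (not-involutive (even n)) (%2≡1⇒even≡false n h)

xor-fixes⇒false : ∀ y z → y xor z ≡ z → y ≡ false
xor-fixes⇒false false z _  = refl
xor-fixes⇒false true  z eq = contradiction (sym eq) (not-¬ refl)

xor-flips⇒true : ∀ y z → y xor z ≡ not z → y ≡ true
xor-flips⇒true true  z _  = refl
xor-flips⇒true false z eq = contradiction eq (not-¬ refl)

xor≡false⇒≡ : ∀ y z → y xor z ≡ false → y ≡ z
xor≡false⇒≡ false z eq = sym eq
xor≡false⇒≡ true  z eq = not-injective (sym eq)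

module _ {V : Set} where

  Matched : (V → Maybe V) → V → Set
  Matched ν v = T (is-just (ν v))

  Perfect : (V → Maybe V) → Set
  Perfect ν = ∀ v → Matched ν v

  just⇒matched : ∀ {ν : V → Maybe V} {v w} → ν v ≡ just w → Matched ν v
  just⇒matched eq rewrite eq = tt

  nothing⇒unmatched : ∀ {ν : V → Maybe V} {v} → ν v ≡ nothing → ¬ Matched ν v
  nothing⇒unmatched eq rewrite eq = λ ()

  matched⇒just : ∀ (ν : V → Maybe V) {v} → Matched ν v → ∃ λ w → ν v ≡ just w
  matched⇒just ν {v} _ with ν v
  ... | just w = w , refl

  module _ (vs : List V) (ν : V → Maybe V) where

    private
      matched? : Decidable (Matched ν)
      matched? = T? ∘ (is-just ∘ ν)

    matchedCount≤length : matchedCount vs ν ≤ length vs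
    matchedCount≤length = length-filter matched? vs

    all-matched⇒matchedCount≡length : All (Matched ν) vs → matchedCount vs ν ≡ length vs
    all-matched⇒matchedCount≡length all = cong length (filter-all matched? all)

    matchedCount-∷-unmatched : ∀ {v} → ¬ Matched ν v → matchedCount (v ∷ vs) ν ≡ matchedCount vs ν
    matchedCount-∷-unmatched unmatched = cong length (filter-reject matched? unmatched)

    perfect-or-deficient : (∀ v → v ∈ vs) → Perfect ν ⊎ matchedCount vs ν < length vs
    perfect-or-deficient complete with length vs ≤? matchedCount vs ν
    ... | no  short = inj₂ (≰⇒> short)
    ... | yes full  = inj₁ λ v →
      proj₂ (∈-filter⁻ matched? {xs = vs} (subst (v ∈_) (sym everyone-kept) (complete v)))
      where
      everyone-kept : filter matched? vs ≡ vs
      everyone-kept = filter-complete matched? {vs} (≤-antisym matchedCount≤length full)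

-- Graphs whose vertices sit injectively on the grid ℕ × S and whose edges join consecutive
-- positions of one strand; these are disjoint unions of paths.
module StrandGraph {V S : Set} (pos : V → ℕ) (str : V → S) where

  infix 4 _⟶_

  _⟶_ : V → V → Set
  u ⟶ v = str u ≡ str v × pos v ≡ suc (pos u)

  ⟶-asym : ∀ {u v} → u ⟶ v → ¬ v ⟶ u
  ⟶-asym (_ , p) (_ , q) = <-asym (≤-reflexive (sym p)) (≤-reflexive (sym q))

  Alternating : (V → Bool) → Set
  Alternating d = ∀ {u v} → u ⟶ v → d v ≡ not (d u)

  Along : (V → Bool) → V → V → Set
  Along d v w = (d v ≡ true × v ⟶ w) ⊎ (d v ≡ false × w ⟶ v)

  along-sym : ∀ {d} → Alternating d → ∀ {u v} → Along d u v → Along d v u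
  along-sym alt (inj₁ (du , u⟶v)) = inj₂ (trans (alt u⟶v) (cong not du) , u⟶v)
  along-sym alt (inj₂ (du , v⟶u)) = inj₁ (not-injective (trans (sym (alt v⟶u)) du) , v⟶u)

  module Decoded (at : ℕ → S → Maybe V)
                 (at-coords : ∀ v → at (pos v) (str v) ≡ just v)
                 (at-sound : ∀ {p q v} → at p q ≡ just v → pos v ≡ p × str v ≡ q) where

    below : ℕ → S → Maybe V
    below zero    q = nothing
    below (suc p) q = at p q

    next prev : V → Maybe V
    next v = at (suc (pos v)) (str v)
    prev v = below (pos v) (str v)

    next-complete : ∀ {u v} → u ⟶ v → next u ≡ just v
    next-complete {v = v} (su , pv) = trans (cong₂ at (sym pv) su) (at-coords v)

    next-sound : ∀ {u v} → next u ≡ just v → u ⟶ v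
    next-sound eq with at-sound eq
    ... | pv , sv = sym sv , pv

    prev-complete : ∀ {u v} → u ⟶ v → prev v ≡ just u
    prev-complete {u} (su , pv) = trans (cong₂ below pv (sym su)) (at-coords u)

    prev-sound : ∀ {u v} → prev v ≡ just u → u ⟶ v
    prev-sound {u} {v} eq with below-sound (pos v) eq
      where
      below-sound : ∀ p {q} → below p q ≡ just u → p ≡ suc (pos u) × str u ≡ q
      below-sound (suc p) eq′ with at-sound eq′
      ... | pu , su = cong suc (sym pu) , su
    ... | pv , su = su , pv

    ⟶-functional : ∀ {u v w} → u ⟶ v → u ⟶ w → v ≡ w
    ⟶-functional u⟶v u⟶w = just-injective (trans (sym (next-complete u⟶v)) (next-complete u⟶w))

    mate : (V → Bool) → V → Maybe V
    mate d v = if d v then next v else prev v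

    along⇒mate : ∀ {d v w} → Along d v w → mate d v ≡ just w
    along⇒mate (inj₁ (dv , v⟶w)) rewrite dv = next-complete v⟶w
    along⇒mate (inj₂ (dv , w⟶v)) rewrite dv = prev-complete w⟶v

    mate⇒along : ∀ {d v w} → mate d v ≡ just w → Along d v w
    mate⇒along {d} {v} eq with d v
    ... | true  = inj₁ (refl , next-sound eq)
    ... | false = inj₂ (refl , prev-sound eq)

    mate-end : ∀ {d v} → d v ≡ true → (∀ {w} → ¬ v ⟶ w) → mate d v ≡ nothing
    mate-end {v = v} dv no-successor rewrite dv with next v in eq
    ... | nothing = refl
    ... | just w  = contradiction (next-sound eq) no-successor

    mate-matched : ∀ {d v} → (d v ≡ true → ∃ (v ⟶_)) → (d v ≡ false → ∃ (_⟶ v)) → Matched (mate d) v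
    mate-matched {d} {v} successor predecessor with d v
    ... | true  = just⇒matched {ν = next}  (next-complete (proj₂ (successor refl)))
    ... | false = just⇒matched {ν = prev} (prev-complete (proj₂ (predecessor refl)))

    module WithAdjacency {Adj : V → V → Set}
             (adj-sound : ∀ {u v} → Adj u v → u ⟶ v ⊎ v ⟶ u)
             (adj-complete : ∀ {u v} → u ⟶ v ⊎ v ⟶ u → Adj u v) where

      along⇒adj : ∀ {d u v} → Along d u v → Adj u v
      along⇒adj (inj₁ (_ , u⟶v)) = adj-complete (inj₁ u⟶v)
      along⇒adj (inj₂ (_ , v⟶u)) = adj-complete (inj₂ v⟶u)

      mate-isMatching : ∀ {d} → Alternating d → IsMatching Adj (mate d)
      mate-isMatching {d} alt u v eq =
        along⇒mate {d} (along-sym alt (mate⇒along {d} eq)) , along⇒adj {d} (mate⇒along {d} eq)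

      module PerfectMatching {d : V → Bool} (alt : Alternating d)
                             (start : ∀ {v} → d v ≡ false → ∃ (_⟶ v))
                             {ν : V → Maybe V} (isMatching : IsMatching Adj ν) (perfect : Perfect ν) where

        along-forward : ∀ {v w} → d v ≡ true → Along d v w → v ⟶ w
        along-forward _  (inj₁ (_ , v⟶w)) = v⟶w
        along-forward dv (inj₂ (dv′ , _)) = contradiction (trans (sym dv) dv′) λ ()

        -- A partner below v is settled by the induction hypothesis
        -- for that partner; a partner above v when d v ≡ false is impossible, because then the
        -- predecessor u of v has d u ≡ true and, by induction, is matched forwards, that is, to v.
        along-at : ∀ n {v w} → pos v ≡ n → ν v ≡ just w → Along d v w
        backward-at : ∀ n {v w} → pos v ≡ n → ν v ≡ just w → w ⟶ v → Along d v w
        forward-at : ∀ n {v w} → pos v ≡ n → ν v ≡ just w → v ⟶ w → Along d v w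

        along-at n pv νv with adj-sound (proj₂ (isMatching _ _ νv))
        ... | inj₁ v⟶w = forward-at n pv νv v⟶w
        ... | inj₂ w⟶v = backward-at n pv νv w⟶v

        backward-at zero    pv _  (_ , pv′) = contradiction (trans (sym pv) pv′) λ ()
        backward-at (suc n) pv νv (_ , pv′) =
          along-sym alt (along-at n (suc-injective (trans (sym pv′) pv)) (proj₁ (isMatching _ _ νv)))

        forward-at n {v} {w} pv νv v⟶w with d v in dv
        ... | true  = inj₁ (refl , v⟶w)
        ... | false with start dv | n
        ...   | u , (_ , pv′) | zero  = contradiction (trans (sym pv) pv′) λ ()
        ...   | u , u⟶v       | suc n = ⊥-elim (⟶-asym u⟶v (subst (v ⟶_) w≡u v⟶w))
          where
          du : d u ≡ true
          du = not-injective (trans (sym (alt u⟶v)) dv)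
          mate-of-u : ∃ λ y → ν u ≡ just y
          mate-of-u = matched⇒just ν (perfect u)
          u⟶mate : u ⟶ proj₁ mate-of-u
          u⟶mate = along-forward du
            (along-at n (suc-injective (trans (sym (proj₂ u⟶v)) pv)) (proj₂ mate-of-u))
          νv≡u : ν v ≡ just u
          νv≡u = subst (λ z → ν z ≡ just u) (⟶-functional u⟶mate u⟶v)
                       (proj₁ (isMatching _ _ (proj₂ mate-of-u)))
          w≡u : w ≡ u
          w≡u = just-injective (trans (sym νv) νv≡u)

        perfect⇒along : ∀ {v w} → ν v ≡ just w → Along d v w
        perfect⇒along = along-at _ refl

        perfect⇒mate : ∀ v → ν v ≡ mate d v
        perfect⇒mate v with matched⇒just ν (perfect v)
        ... | w , νv = trans νv (sym (along⇒mate {d} (perfect⇒along νv)))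

        perfect⇒successor : ∀ {v} → d v ≡ true → ∃ (v ⟶_)
        perfect⇒successor {v} dv with matched⇒just ν (perfect v)
        ... | w , νv = w , along-forward dv (perfect⇒along νv)

suffixXor : ∀ {k} → (Fin (suc k) → Bool) → Fin k → Bool
suffixXor y zero    = xorAll (y ∘ suc)
suffixXor y (suc i) = suffixXor (y ∘ suc) i

suffixXor-step : ∀ {k} (y : Fin (suc k) → Bool) (i j : Fin k) → toℕ j ≡ suc (toℕ i) →
                 suffixXor y i ≡ y (suc i) xor suffixXor y j
suffixXor-step y zero    (suc zero) refl = refl
suffixXor-step y (suc i) (suc j)    eq   = suffixXor-step (y ∘ suc) i j (suc-injective eq)

suffixXor-last : ∀ {k} (y : Fin (suc k) → Bool) (i : Fin k) → suc (toℕ i) ≡ k → suffixXor y i ≡ y (fromℕ k)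
suffixXor-last {suc zero}    y zero    refl = xor-identityʳ (y (suc zero))
suffixXor-last {suc (suc k)} y (suc i) eq   = suffixXor-last (y ∘ suc) i (suc-injective eq)

module _ (m : ℕ) where

  layers : List (XV m)
  layers = map a (allFin m) ++ map b (allFin m)

  layers-length : length layers ≡ m + m
  layers-length = trans (length-++ (map a (allFin m)))
    (cong₂ _+_ (trans (length-map a (allFin m)) allFin-length)
               (trans (length-map b (allFin m)) allFin-length))
    where
    allFin-length : length (allFin m) ≡ m
    allFin-length = length-tabulate id

  allXV-complete : ∀ v → v ∈ allXV m
  allXV-complete s     = here refl
  allXV-complete t     = there (here refl)
  allXV-complete (a i) = there (there (∈-++⁺ˡ (∈-map⁺ a (∈-allFin i))))
  allXV-complete (b i) = there (there (∈-++⁺ʳ (map a (allFin m)) (∈-map⁺ b (∈-allFin i))))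

  half-vertex-count : ⌊ length (allXV m) /2⌋ ≡ suc m
  half-vertex-count = cong suc (trans (cong ⌊_/2⌋ layers-length) (sym (n≡⌊n+n/2⌋ m)))

  msize≤ : ∀ ν → msize (allXV m) ν ≤ suc m
  msize≤ ν = ≤-trans (⌊n/2⌋-mono (matchedCount≤length (allXV m) ν)) (≤-reflexive half-vertex-count)

  msize-perfect : ∀ {ν} → Perfect ν → msize (allXV m) ν ≡ suc m
  msize-perfect {ν} perfect =
    trans (cong ⌊_/2⌋ (all-matched⇒matchedCount≡length (allXV m) ν (universal perfect (allXV m))))
          half-vertex-count

  perfect-or-small : ∀ ν → Perfect ν ⊎ msize (allXV m) ν ≤ m
  perfect-or-small ν with perfect-or-deficient (allXV m) ν allXV-complete
  ... | inj₁ perfect   = inj₁ perfect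
  ... | inj₂ deficient = inj₂ (≤-trans (⌊n/2⌋-mono (s≤s⁻¹ deficient))
                                       (≤-reflexive (trans (cong ⌈_/2⌉ layers-length) (sym (n≡⌈n+n/2⌉ m)))))

module Gadget {n : ℕ} (x : Fin (suc (suc n)) → Bool) where

  m : ℕ
  m = suc n

  total : Bool
  total = xorAll x

  strand : Fin m → Bool
  strand = suffixXor x

  pos : XV m → ℕ
  pos s     = 0
  pos t     = suc m
  pos (a i) = suc (toℕ i)
  pos (b i) = suc (toℕ i)

  str : XV m → Bool
  str s     = total
  str t     = false
  str (a i) = strand i
  str (b i) = not (strand i)

  open StrandGraph pos str

  pos≤ : ∀ v → pos v ≤ suc m
  pos≤ s     = z≤n
  pos≤ t     = ≤-refl
  pos≤ (a i) = m≤n⇒m≤1+n (toℕ<n i)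
  pos≤ (b i) = m≤n⇒m≤1+n (toℕ<n i)

  t-no-successor : ∀ {w} → ¬ t ⟶ w
  t-no-successor {w} (_ , pw) = 1+n≰n (subst (_≤ suc m) pw (pos≤ w))

  side : Bool → Fin m → XV m
  side false = a
  side true  = b

  str-side : ∀ c i → str (side c i) ≡ c xor strand i
  str-side false i = refl
  str-side true  i = refl

  pos-side : ∀ c i → pos (side c i) ≡ suc (toℕ i)
  pos-side false i = refl
  pos-side true  i = refl

  layerVertex : Fin m → Bool → XV m
  layerVertex i q = side (q xor strand i) i

  str-layerVertex : ∀ i q → str (layerVertex i q) ≡ q
  str-layerVertex i q = begin
    str (side (q xor strand i) i)     ≡⟨ str-side (q xor strand i) i ⟩
    (q xor strand i) xor strand i     ≡⟨ xor-assoc q (strand i) (strand i) ⟩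
    q xor (strand i xor strand i)     ≡⟨ cong (q xor_) (xor-same (strand i)) ⟩
    q xor false                       ≡⟨ xor-identityʳ q ⟩
    q                                 ∎

  pos-layerVertex : ∀ {p} (p<m : p < m) q → pos (layerVertex (fromℕ< p<m) q) ≡ suc p
  pos-layerVertex p<m q = trans (pos-side _ (fromℕ< p<m)) (cong suc (toℕ-fromℕ< p<m))

  vertexAt : ℕ → Bool → Maybe (XV m)
  vertexAt zero q with q ≟ total
  ... | yes _ = just s
  ... | no  _ = nothing
  vertexAt (suc p) q with <-cmp p m
  ... | tri< p<m _ _ = just (layerVertex (fromℕ< p<m) q)
  ... | tri≈ _ _ _   = if q then nothing else just t
  ... | tri> _ _ _   = nothing

  vertexAt-layer : ∀ i q → vertexAt (suc (toℕ i)) q ≡ just (layerVertex i q)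
  vertexAt-layer i q with <-cmp (toℕ i) m
  ... | tri< i<m _ _ = cong (λ j → just (layerVertex j q)) (fromℕ<-toℕ i i<m)
  ... | tri≈ i≮m _ _ = contradiction (toℕ<n i) i≮m
  ... | tri> i≮m _ _ = contradiction (toℕ<n i) i≮m

  vertexAt-coords : ∀ v → vertexAt (pos v) (str v) ≡ just v
  vertexAt-coords s with total ≟ total
  ... | yes _    = refl
  ... | no  ≢tot = contradiction refl ≢tot
  vertexAt-coords t with <-cmp m m
  ... | tri< m<m _ _ = contradiction m<m (<-irrefl refl)
  ... | tri≈ _ _ _   = refl
  ... | tri> _ _ m>m = contradiction m>m (<-irrefl refl)
  vertexAt-coords (a i) =
    trans (vertexAt-layer i (strand i)) (cong (λ c → just (side c i)) (xor-same (strand i)))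
  vertexAt-coords (b i) =
    trans (vertexAt-layer i (not (strand i))) (cong (λ c → just (side c i)) (xor-inverseˡ (strand i)))

  vertexAt-sound : ∀ {p q v} → vertexAt p q ≡ just v → pos v ≡ p × str v ≡ q
  vertexAt-sound {zero} {q} eq with q ≟ total
  vertexAt-sound {zero} {q} refl | yes q≡total = refl , sym q≡total
  vertexAt-sound {suc p} {q} eq with <-cmp p m
  vertexAt-sound {suc p} {q} refl     | tri< p<m _ _ = pos-layerVertex p<m q , str-layerVertex (fromℕ< p<m) q
  vertexAt-sound {suc p} {false} refl | tri≈ _ p≡m _ = cong suc (sym p≡m) , refl

  open Decoded vertexAt vertexAt-coords vertexAt-sound

  strand-step : ∀ {i j c} → toℕ j ≡ suc (toℕ i) → x (suc i) ≡ c → strand i ≡ c xor strand j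
  strand-step {i} {j} j≡i+1 xᵢ = trans (suffixXor-step x i j j≡i+1) (cong (_xor strand j) xᵢ)

  arc⇒step : ∀ {u v} → XArc x u v → u ⟶ v ⊎ v ⟶ u
  arc⇒step (s-a zero refl x₀)   = inj₁ (cong (_xor strand zero) x₀ , refl)
  arc⇒step (s-b zero refl x₀)   = inj₁ (cong (_xor strand zero) x₀ , refl)
  arc⇒step (t-a i last xₖ)      = inj₂ (trans (suffixXor-last x i last) xₖ , cong suc (sym last))
  arc⇒step (t-b i last xₖ)      = inj₂ (cong not (trans (suffixXor-last x i last) xₖ) , cong suc (sym last))
  arc⇒step (aa i j j≡i+1 xᵢ)   = inj₁ (strand-step j≡i+1 xᵢ , cong suc j≡i+1)
  arc⇒step (bb i j j≡i+1 xᵢ)   = inj₁ (cong not (strand-step j≡i+1 xᵢ) , cong suc j≡i+1)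
  arc⇒step (ab i j j≡i+1 xᵢ)   = inj₁ (strand-step j≡i+1 xᵢ , cong suc j≡i+1)
  arc⇒step (ba i j j≡i+1 xᵢ)   =
    inj₁ (trans (cong not (strand-step j≡i+1 xᵢ)) (not-involutive (strand j)) , cong suc j≡i+1)

  last-bit : ∀ {i c} → suc (toℕ i) ≡ m → strand i ≡ c → x (fromℕ m) ≡ c
  last-bit {i} last h = trans (sym (suffixXor-last x i last)) h

  layer-bit-false : ∀ {i j} → toℕ j ≡ suc (toℕ i) → strand i ≡ strand j → x (suc i) ≡ false
  layer-bit-false {i} {j} j≡i+1 h =
    xor-fixes⇒false (x (suc i)) (strand j) (trans (sym (suffixXor-step x i j j≡i+1)) h)

  layer-bit-true : ∀ {i j} → toℕ j ≡ suc (toℕ i) → strand i ≡ not (strand j) → x (suc i) ≡ true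
  layer-bit-true {i} {j} j≡i+1 h =
    xor-flips⇒true (x (suc i)) (strand j) (trans (sym (suffixXor-step x i j j≡i+1)) h)

  step⇒adj : ∀ {u v} → u ⟶ v → XAdj x u v
  step⇒adj {s}   {s}         (_ , ())
  step⇒adj {s}   {t}         (_ , ())
  step⇒adj {s}   {a zero}    (h , refl) = inj₁ (s-a zero refl (xor-fixes⇒false (x zero) (strand zero) h))
  step⇒adj {s}   {b zero}    (h , refl) = inj₁ (s-b zero refl (xor-flips⇒true (x zero) (strand zero) h))
  step⇒adj {s}   {a (suc _)} (_ , ())
  step⇒adj {s}   {b (suc _)} (_ , ())
  step⇒adj {t}   t⟶v = contradiction t⟶v t-no-successor
  step⇒adj {a _} {s}         (_ , ())
  step⇒adj {b _} {s}         (_ , ())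
  step⇒adj {a i} {t}         (h , pt) = inj₂ (t-a i last (last-bit last h))
    where
    last : suc (toℕ i) ≡ m
    last = sym (suc-injective pt)
  step⇒adj {b i} {t}         (h , pt) = inj₂ (t-b i last (last-bit last (not-injective h)))
    where
    last : suc (toℕ i) ≡ m
    last = sym (suc-injective pt)
  step⇒adj {a i} {a j} (h , pj) = inj₁ (aa i j (suc-injective pj) (layer-bit-false (suc-injective pj) h))
  step⇒adj {a i} {b j} (h , pj) = inj₁ (ab i j (suc-injective pj) (layer-bit-true (suc-injective pj) h))
  step⇒adj {b i} {a j} (h , pj) = inj₁ (ba i j (suc-injective pj) (layer-bit-true (suc-injective pj) h′))
    where
    h′ : strand i ≡ not (strand j)
    h′ = trans (sym (not-involutive (strand i))) (cong not h)
  step⇒adj {b i} {b j} (h , pj) =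
    inj₁ (bb i j (suc-injective pj) (layer-bit-false (suc-injective pj) (not-injective h)))

  open WithAdjacency {XAdj x} [ arc⇒step , swap ∘ arc⇒step ] [ step⇒adj , swap ∘ step⇒adj ]

  onLayer : ∀ {p} → p < m → ∀ q → ∃ λ w → pos w ≡ suc p × str w ≡ q
  onLayer p<m q = layerVertex (fromℕ< p<m) q , pos-layerVertex p<m q , str-layerVertex (fromℕ< p<m) q

  successor : ∀ v → pos v ≤ m → (pos v ≡ m → str v ≡ false) → ∃ (v ⟶_)
  successor v pv≤m at-m-on-false with m≤n⇒m<n∨m≡n pv≤m
  ... | inj₁ pv<m = let w , pw , sw = onLayer pv<m (str v) in w , sym sw , pw
  ... | inj₂ pv≡m = t , at-m-on-false pv≡m , cong suc (sym pv≡m)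

  predecessor : ∀ v {p} → pos v ≡ suc p → (pos v ≡ 1 → str v ≡ total) → ∃ (_⟶ v)
  predecessor v {zero}  pv at-1-on-total = s , sym (at-1-on-total pv) , pv
  predecessor v {suc p} pv _ =
    let w , pw , sw = onLayer p<m (str v) in w , sw , trans pv (cong suc (sym pw))
    where
    p<m : p < m
    p<m = s≤s⁻¹ (subst (_≤ suc m) pv (pos≤ v))

  -- The strand of s starts at position 0 and the other strand at position 1; startParity v says
  -- that v lies at an even distance from the start of its strand.
  startParity : XV m → Bool
  startParity v = even (pos v) xor (str v xor total)

  startParity-alternating : Alternating startParity
  startParity-alternating {u} {v} (su , pv) = begin
    even (pos v) xor (str v xor total)        ≡⟨ cong₂ (λ p q → even p xor (q xor total)) pv (sym su) ⟩
    not (even (pos u)) xor (str u xor total)  ≡⟨ sym (not-distribˡ-xor (even (pos u)) (str u xor total)) ⟩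
    not (startParity u)                       ∎

  startParity-at : ∀ {v p} → pos v ≡ p → startParity v ≡ even p xor (str v xor total)
  startParity-at {v} pv = cong (λ p → even p xor (str v xor total)) pv

  first-layer-strand : ∀ v → pos v ≡ 1 → startParity v ≡ false → str v ≡ total
  first-layer-strand v pv h = xor≡false⇒≡ (str v) total (trans (sym (startParity-at pv)) h)

  startParity-false⇒predecessor : ∀ {v} → startParity v ≡ false → ∃ (_⟶ v)
  startParity-false⇒predecessor {s} h = contradiction (trans (sym h) (cong not (xor-same total))) λ ()
  startParity-false⇒predecessor {t} h = predecessor t refl λ ()
  startParity-false⇒predecessor {a i} h = predecessor (a i) refl λ pv → first-layer-strand (a i) pv h
  startParity-false⇒predecessor {b i} h = predecessor (b i) refl λ pv → first-layer-strand (b i) pv h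

  open PerfectMatching {startParity} startParity-alternating startParity-false⇒predecessor
    using (perfect⇒mate; perfect⇒successor)

  module OddLength (k-odd : even (suc m) ≡ false) where

    m-even : even m ≡ true
    m-even = not-injective k-odd

    module XorZero (total≡false : total ≡ false) where

      last-layer-strand : ∀ {v} → pos v ≡ m → startParity v ≡ true → str v ≡ false
      last-layer-strand {v} pv h = not-injective (begin
        not (str v)                       ≡⟨ cong not (sym (xor-identityʳ (str v))) ⟩
        not (str v xor false)             ≡⟨ cong₂ (λ e X → e xor (str v xor X)) (sym m-even) (sym total≡false) ⟩
        even m xor (str v xor total)      ≡⟨ sym (startParity-at pv) ⟩
        startParity v                     ≡⟨ h ⟩
        true                              ∎)

      startParity-true⇒successor : ∀ {v} → startParity v ≡ true → ∃ (v ⟶_)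
      startParity-true⇒successor {s}   h = successor s z≤n λ ()
      startParity-true⇒successor {t}   h = contradiction (trans (sym h) (cong₂ _xor_ k-odd total≡false)) λ ()
      startParity-true⇒successor {a i} h = successor (a i) (toℕ<n i) λ pv → last-layer-strand {a i} pv h
      startParity-true⇒successor {b i} h = successor (b i) (toℕ<n i) λ pv → last-layer-strand {b i} pv h

      μ : XV m → Maybe (XV m)
      μ = mate startParity

      μ-isMatching : IsMatching (XAdj x) μ
      μ-isMatching = mate-isMatching {startParity} startParity-alternating

      μ-perfect : Perfect μ
      μ-perfect v =
        mate-matched {startParity} {v} startParity-true⇒successor startParity-false⇒predecessor

      μ-size : msize (allXV m) μ ≡ suc m
      μ-size = msize-perfect m μ-perfect

      μ-matches-t : μ t ≢ nothing
      μ-matches-t μt≡nothing = nothing⇒unmatched {ν = μ} {t} μt≡nothing (μ-perfect t)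

      μ-maximum : IsMaximumMatching (allXV m) (XAdj x) μ
      μ-maximum = μ-isMatching , λ ν _ → subst (msize (allXV m) ν ≤_) (sym μ-size) (msize≤ m ν)

      μ-unique : ∀ ν → IsMaximumMatching (allXV m) (XAdj x) ν → ∀ v → ν v ≡ μ v
      μ-unique ν (ν-isMatching , ν-maximum) with perfect-or-small m ν
      ... | inj₁ ν-perfect = perfect⇒mate ν-isMatching ν-perfect
      ... | inj₂ ν-small   = contradiction (≤-trans ν-large ν-small) 1+n≰n
        where
        ν-large : suc m ≤ msize (allXV m) ν
        ν-large = subst (_≤ msize (allXV m) ν) μ-size (ν-maximum μ μ-isMatching)

    module XorOne (total≡true : total ≡ true) where

      oddPosition : XV m → Bool
      oddPosition v = not (even (pos v))

      oddPosition-alternating : Alternating oddPosition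
      oddPosition-alternating (_ , pv) = cong (not ∘ even) pv

      μ : XV m → Maybe (XV m)
      μ = mate oddPosition

      μ-t : μ t ≡ nothing
      μ-t = mate-end {oddPosition} {t} (cong not k-odd) t-no-successor

      layer-matched : ∀ v {p} → pos v ≡ suc p → p < m → Matched μ v
      layer-matched v {p} pv p<m = mate-matched {oddPosition} {v} forward backward
        where
        forward : oddPosition v ≡ true → ∃ (v ⟶_)
        forward odd = successor v (subst (_≤ m) (sym pv) p<m)
          λ pv≡m → contradiction (trans (sym odd) (trans (cong (not ∘ even) pv≡m) (cong not m-even))) λ ()
        backward : oddPosition v ≡ false → ∃ (_⟶ v)
        backward even′ = predecessor v pv
          λ pv≡1 → contradiction (trans (sym even′) (cong (not ∘ even) pv≡1)) λ ()

      μ-size : msize (allXV m) μ ≡ m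
      μ-size = trans (cong ⌊_/2⌋ matched-count) (sym (n≡⌊n+n/2⌋ m))
        where
        layers-matched : All (Matched μ) (layers m)
        layers-matched = ++⁺ (map⁺ (universal (λ i → layer-matched (a i) refl (toℕ<n i)) (allFin m)))
                             (map⁺ (universal (λ i → layer-matched (b i) refl (toℕ<n i)) (allFin m)))
        t-unmatched : ¬ Matched μ t
        t-unmatched = nothing⇒unmatched {ν = μ} {t} μ-t
        matched-count : matchedCount (allXV m) μ ≡ m + m
        matched-count = begin
          matchedCount (s ∷ t ∷ layers m) μ ≡⟨ matchedCount-∷-unmatched (t ∷ layers m) μ {s} (λ ()) ⟩
          matchedCount (t ∷ layers m) μ     ≡⟨ matchedCount-∷-unmatched (layers m) μ {t} t-unmatched ⟩
          matchedCount (layers m) μ         ≡⟨ all-matched⇒matchedCount≡length (layers m) μ layers-matched ⟩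
          length (layers m)                 ≡⟨ layers-length m ⟩
          m + m                             ∎

      no-perfect-matching : ∀ {ν} → IsMatching (XAdj x) ν → ¬ Perfect ν
      no-perfect-matching ν-isMatching ν-perfect =
        t-no-successor (proj₂ (perfect⇒successor ν-isMatching ν-perfect {t} startParity-t))
        where
        startParity-t : startParity t ≡ true
        startParity-t = cong₂ _xor_ k-odd total≡true

      μ-maximum : IsMaximumMatching (allXV m) (XAdj x) μ
      μ-maximum = mate-isMatching {oddPosition} oddPosition-alternating , maximal
        where
        maximal : ∀ ν → IsMatching (XAdj x) ν → msize (allXV m) ν ≤ msize (allXV m) μ
        maximal ν ν-isMatching with perfect-or-small m ν
        ... | inj₁ ν-perfect = contradiction ν-perfect (no-perfect-matching ν-isMatching)
        ... | inj₂ ν-small   = subst (msize (allXV m) ν ≤_) (sym μ-size) ν-small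

lemma5p5 : (m : ℕ) → 1 < suc m → suc m % 2 ≡ 1 → (x : Fin (suc m) → Bool) →
    (xorAll x ≡ false →
      ∃ λ (μ : XV m → Maybe (XV m)) →
        IsMaximumMatching (allXV m) (XAdj x) μ
        × msize (allXV m) μ ≡ suc m
        × μ t ≢ nothing
        × (∀ (ν : XV m → Maybe (XV m)) → IsMaximumMatching (allXV m) (XAdj x) ν → ∀ v → ν v ≡ μ v))
    × (xorAll x ≡ true →
      ∃ λ (μ : XV m → Maybe (XV m)) →
        IsMaximumMatching (allXV m) (XAdj x) μ
        × msize (allXV m) μ ≡ suc m ∸ 1
        × μ t ≡ nothing)
lemma5p5 zero    (s≤s ()) _ _
lemma5p5 (suc n) _ k%2≡1 x =
    (λ total≡false → let open XorZero total≡false in μ , μ-maximum , μ-size , μ-matches-t , μ-unique)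
  , (λ total≡true  → let open XorOne  total≡true  in μ , μ-maximum , μ-size , μ-t)
  where
  open Gadget x
  k-odd : even (suc m) ≡ false
  k-odd = %2≡1⇒even≡false (suc m) k%2≡1
  open OddLength k-odd
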